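{- Let $d\in\mathbb{N}$ and let $G$ be a subgraph of $Q_n$ with average degree at least $d$. Then $G$ contains at least $\frac{d!\,|G|}{2}$ geodesics of length $d$.
   Context: The hypercube $Q_n$ has vertex set $\{0,1\}^n$, two vertices being adjacent if they differ in exactly one coordinate; the direction of an edge is that coordinate. A path in $Q_n$ is a geodesic if no two of its edges have the same direction; its length is its number of edges. Geodesics are counted as paths (subgraphs), i.e. a path and its reversal count once. $|G|$ is the number of vertices of $G$. -}

module Defs where

open import Data.Bool using (Bool; true; false; not; _∧_; if_then_else_)
open import Data.Nat using (ℕ; zero; suc; _+_)
open import Data.Fin using (Fin)
open import Data.Fin.Properties using (_≟_)
open import Data.Vec using (Vec; []; _∷_; updateAt)
open import Data.List as List using (List; allFin; concatMap)
open import Data.Nat.ListAction using (sum)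
open import Relation.Nullary.Decidable using (⌊_⌋)

Vertex : ℕ → Set
Vertex n = Vec Bool n

flipAt : ∀ {n} → Fin n → Vertex n → Vertex n
flipAt i x = updateAt x i not

allVertices : ∀ n → List (Vertex n)
allVertices zero    = [] List.∷ List.[]
allVertices (suc n) = concatMap (λ v → (false ∷ v) List.∷ (true ∷ v) List.∷ List.[]) (allVertices n)

allDirSeqs : ∀ n d → List (Vec (Fin n) d)
allDirSeqs n zero    = [] List.∷ List.[]
allDirSeqs n (suc d) = concatMap (λ s → List.map (_∷ s) (allFin n)) (allDirSeqs n d)

countᵇ : ∀ {A : Set} → (A → Bool) → List A → ℕ
countᵇ p xs = sum (List.map (λ a → if p a then 1 else 0) xs)

-- A subgraph G of Q_n: a vertex predicate V and an edge predicate E,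
-- where E x i means the edge {x, flipAt i x} (direction i) lies in G.
-- Well-formedness (symmetry, endpoints in V) is imposed in the theorem.

vertexCount : ∀ {n} → (Vertex n → Bool) → ℕ
vertexCount {n} V = countᵇ V (allVertices n)

degreeSum : ∀ {n} → (Vertex n → Bool) → (Vertex n → Fin n → Bool) → ℕ
degreeSum {n} V E = sum (List.map (λ x → countᵇ (E x) (allFin n)) (allVertices n))

distinctDirs : ∀ {n d} → Vec (Fin n) d → Bool
distinctDirs []       = true
distinctDirs (i ∷ is) = not (elemᵇ i is) ∧ distinctDirs is
  where
  elemᵇ : ∀ {n k} → Fin n → Vec (Fin n) k → Bool
  elemᵇ i []       = false
  elemᵇ i (j ∷ js) = if ⌊ i ≟ j ⌋ then true else elemᵇ i js

walkInG : ∀ {n d} → (Vertex n → Bool) → (Vertex n → Fin n → Bool)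
        → Vertex n → Vec (Fin n) d → Bool
walkInG V E x []       = V x
walkInG V E x (i ∷ is) = V x ∧ E x i ∧ walkInG V E (flipAt i x) is

walkEnd : ∀ {n d} → Vertex n → Vec (Fin n) d → Vertex n
walkEnd x []       = x
walkEnd x (i ∷ is) = walkEnd (flipAt i x) is

lexLeq : ∀ {n} → Vertex n → Vertex n → Bool
lexLeq []       []       = true
lexLeq (false ∷ xs) (false ∷ ys) = lexLeq xs ys
lexLeq (true  ∷ xs) (true  ∷ ys) = lexLeq xs ys
lexLeq (false ∷ xs) (true  ∷ ys) = true
lexLeq (true  ∷ xs) (false ∷ ys) = false

-- A geodesic of length d in G is a path subgraph; it is determined by its
-- vertex sequence up to reversal. A geodesic of length d ≥ 1 has two distinct
-- endpoints (distinct directions flip distinct coordinates), so each geodesic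
-- corresponds to exactly one oriented walk (start x, directions is) whose start
-- is lexicographically ≤ its end; for d = 0 the single vertex is counted once.
-- Such oriented walks are exactly what we count.
isCanonicalGeodesic : ∀ {n d} → (Vertex n → Bool) → (Vertex n → Fin n → Bool)
                    → Vertex n → Vec (Fin n) d → Bool
isCanonicalGeodesic V E x is =
  distinctDirs is ∧ walkInG V E x is ∧ lexLeq x (walkEnd x is)

geodesicCount : ∀ {n} → (Vertex n → Bool) → (Vertex n → Fin n → Bool) → ℕ → ℕ
geodesicCount {n} V E d =
  sum (List.map (λ x → countᵇ (isCanonicalGeodesic V E x) (allDirSeqs n d))
                (allVertices n))

-- Fix an ordering of the directions, put a walker on every vertex of G and process the directions
-- in order: at direction j, the walkers at the two ends of each edge of direction j swap places.
-- Every walker traces a geodesic whose directions increase along the ordering, the walks have total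
-- length equal to the degree sum, which is at least d |G|, and the length-d stretches of all walkers
-- are distinct increasing geodesics; so there are at least |G| increasing geodesics of length d.
-- A geodesic of length d is increasing for a fraction 1/d! of the orderings, so averaging over the
-- orderings gives d! |G| oriented geodesics, and reversal pairs these up.
module Submission where

open import Algebra using (CommutativeMonoid)
import Algebra.Properties.CommutativeSemigroup as CommSemigroupProperties
open import Data.Bool using (Bool; true; false; not; _∧_; if_then_else_)
open import Data.Bool.Properties using (∧-commutativeMonoid; ∧-identityʳ; ∧-zeroʳ; ∧-assoc)
open import Data.Fin using (Fin; zero; suc)
open import Data.Fin.Properties using (_≟_)
open import Data.List as List using (List; []; _∷_; _++_; concatMap; allFin; tabulate)
open import Data.List.Properties using (map-tabulate)
open import Data.Nat using (ℕ; zero; suc; _+_; _*_; _∸_; _≤_; _!; z≤n; s≤s⁻¹)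
open import Data.Nat.ListAction using (sum)
open import Data.Nat.Properties hiding (_≟_)
open import Data.Nat.Tactic.RingSolver using (solve-∀)
open import Data.Vec using (Vec; []; _∷_)
open import Function using (_∘_; id)
open import Relation.Binary.PropositionalEquality
open import Relation.Nullary.Decidable using (⌊_⌋; yes; no)
open import Relation.Nullary.Negation using (contradiction)

open import Defs

module + = CommSemigroupProperties +-commutativeSemigroup
module ∧ = CommSemigroupProperties (CommutativeMonoid.commutativeSemigroup ∧-commutativeMonoid)

open ≤-Reasoning

sumBy : {A : Set} → List A → (A → ℕ) → ℕ
sumBy xs f = sum (List.map f xs)

private variable A B : Set

sumBy-cong : (xs : List A) {f g : A → ℕ} → (∀ a → f a ≡ g a) → sumBy xs f ≡ sumBy xs g
sumBy-cong []       f≗g = refl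
sumBy-cong (x ∷ xs) f≗g = cong₂ _+_ (f≗g x) (sumBy-cong xs f≗g)

sumBy-mono : (xs : List A) {f g : A → ℕ} → (∀ a → f a ≤ g a) → sumBy xs f ≤ sumBy xs g
sumBy-mono []       f≤g = z≤n
sumBy-mono (x ∷ xs) f≤g = +-mono-≤ (f≤g x) (sumBy-mono xs f≤g)

sumBy-zero : (xs : List A) → sumBy xs (λ _ → 0) ≡ 0
sumBy-zero []       = refl
sumBy-zero (x ∷ xs) = sumBy-zero xs

sumBy-+ : (xs : List A) (f g : A → ℕ) → sumBy xs (λ a → f a + g a) ≡ sumBy xs f + sumBy xs g
sumBy-+ []       f g = refl
sumBy-+ (x ∷ xs) f g = begin-equality
  f x + g x + sumBy xs (λ a → f a + g a)   ≡⟨ cong (f x + g x +_) (sumBy-+ xs f g) ⟩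
  f x + g x + (sumBy xs f + sumBy xs g)    ≡⟨ +.interchange (f x) (g x) _ _ ⟩
  f x + sumBy xs f + (g x + sumBy xs g)    ∎

sumBy-*ˡ : (xs : List A) (c : ℕ) (f : A → ℕ) → sumBy xs (λ a → c * f a) ≡ c * sumBy xs f
sumBy-*ˡ []       c f = sym (*-zeroʳ c)
sumBy-*ˡ (x ∷ xs) c f = trans (cong (c * f x +_) (sumBy-*ˡ xs c f)) (sym (*-distribˡ-+ c (f x) _))

sumBy-++ : (xs ys : List A) (f : A → ℕ) → sumBy (xs ++ ys) f ≡ sumBy xs f + sumBy ys f
sumBy-++ []       ys f = refl
sumBy-++ (x ∷ xs) ys f = trans (cong (f x +_) (sumBy-++ xs ys f)) (sym (+-assoc (f x) _ _))

sumBy-comm : (xs : List A) (ys : List B) (f : A → B → ℕ)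
  → sumBy xs (λ a → sumBy ys (f a)) ≡ sumBy ys (λ b → sumBy xs (λ a → f a b))
sumBy-comm []       ys f = sym (sumBy-zero ys)
sumBy-comm (x ∷ xs) ys f = begin-equality
  sumBy ys (f x) + sumBy xs (λ a → sumBy ys (f a))        ≡⟨ cong (sumBy ys (f x) +_) (sumBy-comm xs ys f) ⟩
  sumBy ys (f x) + sumBy ys (λ b → sumBy xs (λ a → f a b)) ≡⟨ sym (sumBy-+ ys (f x) _) ⟩
  sumBy ys (λ b → f x b + sumBy xs (λ a → f a b))          ∎

sumBy-map : (g : B → A) (xs : List B) (f : A → ℕ) → sumBy (List.map g xs) f ≡ sumBy xs (f ∘ g)
sumBy-map g []       f = refl
sumBy-map g (x ∷ xs) f = cong (f (g x) +_) (sumBy-map g xs f)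

sumBy-concatMap : (g : B → List A) (xs : List B) (f : A → ℕ)
  → sumBy (concatMap g xs) f ≡ sumBy xs (λ b → sumBy (g b) f)
sumBy-concatMap g []       f = refl
sumBy-concatMap g (x ∷ xs) f =
  trans (sumBy-++ (g x) (concatMap g xs) f) (cong (sumBy (g x) f +_) (sumBy-concatMap g xs f))

infixr 7 _⊙_
_⊙_ : Bool → ℕ → ℕ
b ⊙ t = if b then t else 0

⊙-∧ : ∀ b c t → (b ∧ c) ⊙ t ≡ b ⊙ c ⊙ t
⊙-∧ true  c t = refl
⊙-∧ false c t = refl

⊙-comm : ∀ b c t → b ⊙ c ⊙ t ≡ c ⊙ b ⊙ t
⊙-comm true  c     t = refl
⊙-comm false true  t = refl
⊙-comm false false t = refl

⊙-+ : ∀ b s t → b ⊙ (s + t) ≡ b ⊙ s + b ⊙ t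
⊙-+ true  s t = refl
⊙-+ false s t = refl

⊙-*ˡ : ∀ b c t → b ⊙ (c * t) ≡ c * (b ⊙ t)
⊙-*ˡ true  c t = refl
⊙-*ˡ false c t = sym (*-zeroʳ c)

⊙-sumBy : ∀ b (xs : List A) f → b ⊙ sumBy xs f ≡ sumBy xs (λ a → b ⊙ f a)
⊙-sumBy true  xs f = refl
⊙-sumBy false xs f = sym (sumBy-zero xs)

⊙-monoʳ-≤ : ∀ b {s t} → s ≤ t → b ⊙ s ≤ b ⊙ t
⊙-monoʳ-≤ true  s≤t = s≤t
⊙-monoʳ-≤ false s≤t = z≤n

if-⊙ : ∀ b s t → (if b then s else t) ≡ b ⊙ s + not b ⊙ t
if-⊙ true  s t = sym (+-identityʳ s)
if-⊙ false s t = refl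

⊙-split : ∀ b t → b ⊙ t + not b ⊙ t ≡ t
⊙-split true  t = +-identityʳ t
⊙-split false t = refl

private variable n m k : ℕ

Dirs : ℕ → Set
Dirs n = Fin n → Bool

_≟ᵇ_ : Fin n → Fin n → Bool
i ≟ᵇ j = ⌊ i ≟ j ⌋

≟ᵇ-sym : (i j : Fin n) → i ≟ᵇ j ≡ j ≟ᵇ i
≟ᵇ-sym i j with i ≟ j | j ≟ i
... | yes _   | yes _   = refl
... | yes i≡j | no  j≢i = contradiction (sym i≡j) j≢i
... | no  i≢j | yes j≡i = contradiction (sym j≡i) i≢j
... | no  _   | no  _   = refl

≟ᵇ-suc : (i j : Fin n) → suc i ≟ᵇ suc j ≡ i ≟ᵇ j
≟ᵇ-suc i j with i ≟ j
... | yes _ = refl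
... | no  _ = refl

infixl 6 _─_
_─_ : Dirs n → Fin n → Dirs n
(A ─ j) i = A i ∧ not (i ≟ᵇ j)

─-comm : (A : Dirs n) (i j l : Fin n) → (A ─ i ─ j) l ≡ (A ─ j ─ i) l
─-comm A i j l = ∧.xy∙z≈xz∙y (A l) (not (l ≟ᵇ i)) (not (l ≟ᵇ j))

sumFin : (Fin n → ℕ) → ℕ
sumFin f = sumBy (allFin _) f

sumFin-cong : {f g : Fin n → ℕ} → (∀ i → f i ≡ g i) → sumFin f ≡ sumFin g
sumFin-cong = sumBy-cong (allFin _)

sumFin-mono : {f g : Fin n → ℕ} → (∀ i → f i ≤ g i) → sumFin f ≤ sumFin g
sumFin-mono = sumBy-mono (allFin _)

sumFin-+ : (f g : Fin n → ℕ) → sumFin (λ i → f i + g i) ≡ sumFin f + sumFin g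
sumFin-+ = sumBy-+ (allFin _)

sumFin-*ˡ : (c : ℕ) (f : Fin n → ℕ) → sumFin (λ i → c * f i) ≡ c * sumFin f
sumFin-*ˡ = sumBy-*ˡ (allFin _)

sumFin-comm : (f : Fin n → Fin m → ℕ)
  → sumFin (λ i → sumFin (f i)) ≡ sumFin (λ j → sumFin (λ i → f i j))
sumFin-comm = sumBy-comm (allFin _) (allFin _)

⊙-sumFin : ∀ b (f : Fin n → ℕ) → b ⊙ sumFin f ≡ sumFin (λ i → b ⊙ f i)
⊙-sumFin b = ⊙-sumBy b (allFin _)

sumFin-suc : (f : Fin (suc n) → ℕ) → sumFin f ≡ f zero + sumFin (f ∘ suc)
sumFin-suc {n} f = cong (f zero +_) (begin-equality
  sumBy (tabulate suc) f               ≡⟨ cong (λ xs → sumBy xs f) (sym (map-tabulate id suc)) ⟩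
  sumBy (List.map suc (allFin n)) f    ≡⟨ sumBy-map suc (allFin n) f ⟩
  sumFin (f ∘ suc)                     ∎)

sumFin-delta : ∀ {n} (j : Fin n) (h : Fin n → ℕ) → sumFin (λ i → (i ≟ᵇ j) ⊙ h i) ≡ h j
sumFin-delta {suc n} zero h = begin-equality
  sumFin (λ i → (i ≟ᵇ zero) ⊙ h i)   ≡⟨ sumFin-suc (λ i → (i ≟ᵇ zero) ⊙ h i) ⟩
  h zero + sumFin {n} (λ _ → 0)      ≡⟨ cong (h zero +_) (sumBy-zero (allFin n)) ⟩
  h zero + 0                         ≡⟨ +-identityʳ _ ⟩
  h zero                             ∎
sumFin-delta (suc j) h = begin-equality
  sumFin (λ i → (i ≟ᵇ suc j) ⊙ h i)
    ≡⟨ sumFin-suc (λ i → (i ≟ᵇ suc j) ⊙ h i) ⟩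
  sumFin (λ i → (suc i ≟ᵇ suc j) ⊙ h (suc i))
    ≡⟨ sumFin-cong (λ i → cong (_⊙ h (suc i)) (≟ᵇ-suc i j)) ⟩
  sumFin (λ i → (i ≟ᵇ j) ⊙ h (suc i))
    ≡⟨ sumFin-delta j (h ∘ suc) ⟩
  h (suc j)
    ∎

sumFin-─ : ∀ {n} (A : Dirs n) {j : Fin n} (h : Fin n → ℕ) → A j ≡ true
  → sumFin (λ i → A i ⊙ h i) ≡ h j + sumFin (λ i → (A ─ j) i ⊙ h i)
sumFin-─ {n} A {j} h Aj = begin-equality
  sumFin (λ i → A i ⊙ h i)                                ≡⟨ sumFin-cong split ⟩
  sumFin (λ i → (i ≟ᵇ j) ⊙ h i + rest i)                  ≡⟨ sumFin-+ (λ i → (i ≟ᵇ j) ⊙ h i) rest ⟩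
  sumFin (λ i → (i ≟ᵇ j) ⊙ h i) + sumFin rest             ≡⟨ cong (_+ sumFin rest) (sumFin-delta j h) ⟩
  h j + sumFin rest                                       ∎
  where
  rest : Fin n → ℕ
  rest i = (A ─ j) i ⊙ h i
  split : ∀ i → A i ⊙ h i ≡ (i ≟ᵇ j) ⊙ h i + rest i
  split i with i ≟ j
  ... | yes refl rewrite Aj = sym (+-identityʳ _)
  ... | no  _    with A i
  ...   | true  = refl
  ...   | false = refl

size : Dirs n → ℕ
size A = sumFin (λ i → A i ⊙ 1)

size-─ : (A : Dirs n) {j : Fin n} → A j ≡ true → size A ≡ suc (size (A ─ j))
size-─ A Aj = sumFin-─ A (λ _ → 1) Aj

size-zero : (A : Dirs n) (j : Fin n) → size A ≡ 0 → A j ≡ false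
size-zero A j |A|≡0 with A j in Aj
... | false = refl
... | true  = contradiction (trans (sym |A|≡0) (size-─ A Aj)) λ ()

sumFin-⊙-const : (A : Dirs n) (c : ℕ) → sumFin (λ j → A j ⊙ c) ≡ size A * c
sumFin-⊙-const A c = begin-equality
  sumFin (λ j → A j ⊙ c)          ≡⟨ sumFin-cong (λ j → ⊙-unit (A j)) ⟩
  sumFin (λ j → c * (A j ⊙ 1))    ≡⟨ sumFin-*ˡ c (λ j → A j ⊙ 1) ⟩
  c * size A                      ≡⟨ *-comm c (size A) ⟩
  size A * c                      ∎
  where
  ⊙-unit : ∀ b → b ⊙ c ≡ c * (b ⊙ 1)
  ⊙-unit true  = sym (*-identityʳ c)
  ⊙-unit false = sym (*-zeroʳ c)

sumFin-exchange : (A : Dirs n) (e : Fin n → Bool) (F : Fin n → Fin n → Dirs n → ℕ)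
  → (∀ i j {B C} → (∀ l → B l ≡ C l) → F i j B ≡ F i j C)
  → sumFin (λ i → (A i ∧ e i) ⊙ sumFin (λ j → (A ─ i) j ⊙ F i j (A ─ i ─ j)))
  ≡ sumFin (λ j → A j ⊙ sumFin (λ i → ((A ─ j) i ∧ e i) ⊙ F i j (A ─ j ─ i)))
sumFin-exchange A e F F-cong = begin-equality
  sumFin (λ i → (A i ∧ e i) ⊙ sumFin (λ j → (A ─ i) j ⊙ F i j (A ─ i ─ j)))
    ≡⟨ sumFin-cong (λ i → ⊙-sumFin (A i ∧ e i) (λ j → (A ─ i) j ⊙ F i j (A ─ i ─ j))) ⟩
  sumFin (λ i → sumFin (λ j → (A i ∧ e i) ⊙ (A ─ i) j ⊙ F i j (A ─ i ─ j)))
    ≡⟨ sumFin-comm (λ i j → (A i ∧ e i) ⊙ (A ─ i) j ⊙ F i j (A ─ i ─ j)) ⟩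
  sumFin (λ j → sumFin (λ i → (A i ∧ e i) ⊙ (A ─ i) j ⊙ F i j (A ─ i ─ j)))
    ≡⟨ sumFin-cong (λ j → sumFin-cong (λ i → swap i j)) ⟩
  sumFin (λ j → sumFin (λ i → A j ⊙ ((A ─ j) i ∧ e i) ⊙ F i j (A ─ j ─ i)))
    ≡⟨ sumFin-cong (λ j → sym (⊙-sumFin (A j) (λ i → ((A ─ j) i ∧ e i) ⊙ F i j (A ─ j ─ i)))) ⟩
  sumFin (λ j → A j ⊙ sumFin (λ i → ((A ─ j) i ∧ e i) ⊙ F i j (A ─ j ─ i)))
    ∎
  where
  ⊙-exchange : ∀ a b c q t → (a ∧ c) ⊙ (b ∧ not q) ⊙ t ≡ b ⊙ ((a ∧ not q) ∧ c) ⊙ t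
  ⊙-exchange false b     c     q t = sym (⊙-comm b _ t)
  ⊙-exchange true  false c     q t = ⊙-comm c false t
  ⊙-exchange true  true  true  q t = cong (_⊙ t) (sym (∧-identityʳ (not q)))
  ⊙-exchange true  true  false q t = cong (_⊙ t) (sym (∧-zeroʳ (not q)))
  swap : ∀ i j
    → (A i ∧ e i) ⊙ (A ─ i) j ⊙ F i j (A ─ i ─ j) ≡ A j ⊙ ((A ─ j) i ∧ e i) ⊙ F i j (A ─ j ─ i)
  swap i j = begin-equality
    (A i ∧ e i) ⊙ (A j ∧ not (j ≟ᵇ i)) ⊙ F i j (A ─ i ─ j)
      ≡⟨ cong (λ q → (A i ∧ e i) ⊙ (A j ∧ not q) ⊙ F i j (A ─ i ─ j)) (≟ᵇ-sym j i) ⟩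
    (A i ∧ e i) ⊙ (A j ∧ not (i ≟ᵇ j)) ⊙ F i j (A ─ i ─ j)
      ≡⟨ ⊙-exchange (A i) (A j) (e i) (i ≟ᵇ j) _ ⟩
    A j ⊙ ((A ─ j) i ∧ e i) ⊙ F i j (A ─ i ─ j)
      ≡⟨ cong (λ t → A j ⊙ ((A ─ j) i ∧ e i) ⊙ t) (F-cong i j (─-comm A i j)) ⟩
    A j ⊙ ((A ─ j) i ∧ e i) ⊙ F i j (A ─ j ─ i)
      ∎

sumFin-⊙-cong : (A : Dirs n) {f g : Fin n → ℕ} → (∀ j → A j ≡ true → f j ≡ g j)
  → sumFin (λ j → A j ⊙ f j) ≡ sumFin (λ j → A j ⊙ g j)
sumFin-⊙-cong A f≗g = sumFin-cong pointwise
  where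
  pointwise : ∀ j → A j ⊙ _ ≡ A j ⊙ _
  pointwise j with A j in Aj
  ... | true  = f≗g j Aj
  ... | false = refl

sumFin-⊙-mono : (A : Dirs n) {f g : Fin n → ℕ} → (∀ j → A j ≡ true → f j ≤ g j)
  → sumFin (λ j → A j ⊙ f j) ≤ sumFin (λ j → A j ⊙ g j)
sumFin-⊙-mono A f≤g = sumFin-mono pointwise
  where
  pointwise : ∀ j → A j ⊙ _ ≤ A j ⊙ _
  pointwise j with A j in Aj
  ... | true  = f≤g j Aj
  ... | false = z≤n

size-─-pred : (A : Dirs n) {j : Fin n} → size A ≡ suc m → A j ≡ true → size (A ─ j) ≡ m
size-─-pred A |A|≡1+m Aj = suc-injective (trans (sym (size-─ A Aj)) |A|≡1+m)

-- Each ordering of A once, provided A has exactly m elements.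
orderings : ℕ → Dirs n → List (List (Fin n))
orderings zero    A = [] ∷ []
orderings (suc m) A =
  concatMap (λ j → if A j then List.map (j ∷_) (orderings m (A ─ j)) else []) (allFin _)

sumBy-orderings : ∀ {n} (m : ℕ) (A : Dirs n) (f : List (Fin n) → ℕ)
  → sumBy (orderings (suc m) A) f ≡ sumFin (λ j → A j ⊙ sumBy (orderings m (A ─ j)) (f ∘ (j ∷_)))
sumBy-orderings {n} m A f = trans (sumBy-concatMap _ (allFin n) f) (sumFin-cong branch)
  where
  branch : ∀ j → sumBy (if A j then List.map (j ∷_) (orderings m (A ─ j)) else []) f
               ≡ A j ⊙ sumBy (orderings m (A ─ j)) (f ∘ (j ∷_))
  branch j with A j
  ... | true  = sumBy-map (j ∷_) (orderings m (A ─ j)) f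
  ... | false = refl

sumBy-orderings-const : (m : ℕ) (A : Dirs n) (c : ℕ) → size A ≡ m
  → sumBy (orderings m A) (λ _ → c) ≡ m ! * c
sumBy-orderings-const zero    A c _       = refl
sumBy-orderings-const (suc m) A c |A|≡1+m = begin-equality
  sumBy (orderings (suc m) A) (λ _ → c)
    ≡⟨ sumBy-orderings m A (λ _ → c) ⟩
  sumFin (λ j → A j ⊙ sumBy (orderings m (A ─ j)) (λ _ → c))
    ≡⟨ sumFin-⊙-cong A (λ j Aj → sumBy-orderings-const m (A ─ j) c (size-─-pred A |A|≡1+m Aj)) ⟩
  sumFin (λ j → A j ⊙ (m ! * c))        ≡⟨ sumFin-⊙-const A (m ! * c) ⟩
  size A * (m ! * c)                    ≡⟨ cong (_* (m ! * c)) |A|≡1+m ⟩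
  suc m * (m ! * c)                     ≡⟨ *-assoc (suc m) (m !) c ⟨
  suc m ! * c                           ∎

sumBy-orderings-sumBy : ∀ {n} (m : ℕ) (A : Dirs n) (h : Fin n → ℕ) → size A ≡ m
  → sumBy (orderings m A) (λ L → sumBy L h) ≡ m ! * sumFin (λ j → A j ⊙ h j)
sumBy-orderings-sumBy {n} zero A h |A|≡0 = sym (begin-equality
  1 * sumFin (λ j → A j ⊙ h j)   ≡⟨ *-identityˡ _ ⟩
  sumFin (λ j → A j ⊙ h j)       ≡⟨ sumFin-cong (λ j → cong (_⊙ h j) (size-zero A j |A|≡0)) ⟩
  sumFin {n} (λ _ → 0)           ≡⟨ sumBy-zero (allFin n) ⟩
  0                              ∎)
sumBy-orderings-sumBy (suc m) A h |A|≡1+m = begin-equality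
  sumBy (orderings (suc m) A) (λ L → sumBy L h)
    ≡⟨ sumBy-orderings m A (λ L → sumBy L h) ⟩
  sumFin (λ j → A j ⊙ sumBy (orderings m (A ─ j)) (λ L → h j + sumBy L h))
    ≡⟨ sumFin-⊙-cong A step ⟩
  sumFin (λ j → A j ⊙ (m ! * sumFin (λ i → A i ⊙ h i)))
    ≡⟨ sumFin-⊙-const A (m ! * sumFin (λ i → A i ⊙ h i)) ⟩
  size A * (m ! * sumFin (λ i → A i ⊙ h i))
    ≡⟨ cong (_* (m ! * sumFin (λ i → A i ⊙ h i))) |A|≡1+m ⟩
  suc m * (m ! * sumFin (λ i → A i ⊙ h i))
    ≡⟨ *-assoc (suc m) (m !) _ ⟨
  suc m ! * sumFin (λ i → A i ⊙ h i)
    ∎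
  where
  step : ∀ j → A j ≡ true
    → sumBy (orderings m (A ─ j)) (λ L → h j + sumBy L h) ≡ m ! * sumFin (λ i → A i ⊙ h i)
  step j Aj = begin-equality
    sumBy (orderings m (A ─ j)) (λ L → h j + sumBy L h)
      ≡⟨ sumBy-+ (orderings m (A ─ j)) (λ _ → h j) (λ L → sumBy L h) ⟩
    sumBy (orderings m (A ─ j)) (λ _ → h j) + sumBy (orderings m (A ─ j)) (λ L → sumBy L h)
      ≡⟨ cong₂ _+_ (sumBy-orderings-const m (A ─ j) (h j) |A─j|≡m)
                   (sumBy-orderings-sumBy m (A ─ j) h |A─j|≡m) ⟩
    m ! * h j + m ! * sumFin (λ i → (A ─ j) i ⊙ h i)
      ≡⟨ *-distribˡ-+ (m !) (h j) _ ⟨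
    m ! * (h j + sumFin (λ i → (A ─ j) i ⊙ h i))
      ≡⟨ cong (m ! *_) (sumFin-─ A h Aj) ⟨
    m ! * sumFin (λ i → A i ⊙ h i)
      ∎
    where
    |A─j|≡m : size (A ─ j) ≡ m
    |A─j|≡m = size-─-pred A |A|≡1+m Aj

allDirs : Dirs n
allDirs _ = true

size-allDirs : ∀ n → size (allDirs {n}) ≡ n
size-allDirs zero    = refl
size-allDirs (suc n) = trans (sumFin-suc {n} (λ _ → 1)) (cong suc (size-allDirs n))

allOrderings : ∀ n → List (List (Fin n))
allOrderings n = orderings n allDirs

flipAt-involutive : (j : Fin n) (x : Vertex n) → flipAt j (flipAt j x) ≡ x
flipAt-involutive zero    (true  ∷ x) = refl
flipAt-involutive zero    (false ∷ x) = refl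
flipAt-involutive (suc j) (b ∷ x)     = cong (b ∷_) (flipAt-involutive j x)

sumCube : (Vertex n → ℕ) → ℕ
sumCube f = sumBy (allVertices _) f

sumCube-suc : (f : Vertex (suc n) → ℕ) → sumCube f ≡ sumCube (λ v → f (false ∷ v) + f (true ∷ v))
sumCube-suc {n} f = trans (sumBy-concatMap _ (allVertices n) f)
  (sumBy-cong (allVertices n) (λ v → cong (f (false ∷ v) +_) (+-identityʳ (f (true ∷ v)))))

sumCube-flipAt : (j : Fin n) (f : Vertex n → ℕ) → sumCube (f ∘ flipAt j) ≡ sumCube f
sumCube-flipAt zero    f = begin-equality
  sumCube (f ∘ flipAt zero)
    ≡⟨ sumCube-suc (f ∘ flipAt zero) ⟩
  sumCube (λ v → f (true ∷ v) + f (false ∷ v))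
    ≡⟨ sumBy-cong (allVertices _) (λ v → +-comm (f (true ∷ v)) _) ⟩
  sumCube (λ v → f (false ∷ v) + f (true ∷ v))
    ≡⟨ sumCube-suc f ⟨
  sumCube f
    ∎
sumCube-flipAt (suc j) f = begin-equality
  sumCube (f ∘ flipAt (suc j))
    ≡⟨ sumCube-suc (f ∘ flipAt (suc j)) ⟩
  sumCube (λ v → f (false ∷ flipAt j v) + f (true ∷ flipAt j v))
    ≡⟨ sumCube-flipAt j (λ v → f (false ∷ v) + f (true ∷ v)) ⟩
  sumCube (λ v → f (false ∷ v) + f (true ∷ v))
    ≡⟨ sumCube-suc f ⟨
  sumCube f
    ∎

lexLeq-total : (x z : Vertex n) → lexLeq x z ≡ false → lexLeq z x ≡ true
lexLeq-total []          []          ()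
lexLeq-total (false ∷ x) (false ∷ z) x≰z = lexLeq-total x z x≰z
lexLeq-total (true  ∷ x) (true  ∷ z) x≰z = lexLeq-total x z x≰z
lexLeq-total (true  ∷ x) (false ∷ z) _   = refl

_∈ᵇ_ : Fin n → Vec (Fin n) k → Bool
i ∈ᵇ []       = false
i ∈ᵇ (j ∷ js) = if i ≟ᵇ j then true else i ∈ᵇ js

distinctDirs-∷ : (i : Fin n) (s : Vec (Fin n) k) → distinctDirs (i ∷ s) ≡ not (i ∈ᵇ s) ∧ distinctDirs s
distinctDirs-∷ i []       = refl
distinctDirs-∷ i (j ∷ js) with i ≟ j
... | yes _ = refl
... | no  _ = not-∧-exchange {e = i ∈ᵇ js} {d = distinctDirs js} (distinctDirs-∷ i js)
  where
  -- h and h′ stand for the membership tests local to distinctDirs, which cannot be named here.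
  not-∧-exchange : ∀ {h h′ e d} → not h ∧ d ≡ not e ∧ d → not h ∧ not h′ ∧ d ≡ not e ∧ not h′ ∧ d
  not-∧-exchange {h} {h′} {e} {d} eq = trans (∧.x∙yz≈y∙xz (not h) (not h′) d)
    (trans (cong (not h′ ∧_) eq) (∧.x∙yz≈y∙xz (not h′) (not e) d))

allIn : Dirs n → Vec (Fin n) k → Bool
allIn A []      = true
allIn A (i ∷ s) = A i ∧ allIn A s

allIn-─ : (A : Dirs n) (i : Fin n) (s : Vec (Fin n) k) → allIn (A ─ i) s ≡ allIn A s ∧ not (i ∈ᵇ s)
allIn-─ A i []       = refl
allIn-─ A i (j ∷ js) rewrite allIn-─ A i js | ≟ᵇ-sym j i with A j | i ≟ j
... | false | _     = refl
... | true  | yes _ = sym (∧-zeroʳ (allIn A js))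
... | true  | no  _ = refl

allIn-allDirs : (s : Vec (Fin n) k) → allIn allDirs s ≡ true
allIn-allDirs []      = refl
allIn-allDirs (i ∷ s) = allIn-allDirs s

-- Geodesics of a subgraph

module Subgraph {n : ℕ} (V : Vertex n → Bool) (E : Vertex n → Fin n → Bool)
  (E-sym : ∀ x i → E x i ≡ E (flipAt i x) i)
  (E⇒V : ∀ x i → E x i ≡ true → V x ≡ true) where

  E⇒V-flip : ∀ x i → E x i ≡ true → V (flipAt i x) ≡ true
  E⇒V-flip x i Exi = E⇒V (flipAt i x) i (trans (sym (E-sym x i)) Exi)

  sumCube-edge-flip : (j : Fin n) (F : Vertex n → Vertex n → ℕ)
    → sumCube (λ x → E x j ⊙ F x (flipAt j x)) ≡ sumCube (λ y → E y j ⊙ F (flipAt j y) y)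
  sumCube-edge-flip j F = trans (sym (sumCube-flipAt j _))
    (sumBy-cong (allVertices n) λ y →
      cong₂ (λ e z → e ⊙ F (flipAt j y) z) (sym (E-sym y j)) (flipAt-involutive j y))

  sumCube-swap-along : (j : Fin n) (f : Vertex n → ℕ)
    → sumCube (λ x → if E x j then f (flipAt j x) else f x) ≡ sumCube f
  sumCube-swap-along j f = begin-equality
    sumCube (λ x → if E x j then f (flipAt j x) else f x)
      ≡⟨ sumBy-cong (allVertices n) (λ x → if-⊙ (E x j) (f (flipAt j x)) (f x)) ⟩
    sumCube (λ x → E x j ⊙ f (flipAt j x) + not (E x j) ⊙ f x)
      ≡⟨ sumBy-+ (allVertices n) _ _ ⟩
    sumCube (λ x → E x j ⊙ f (flipAt j x)) + sumCube (λ x → not (E x j) ⊙ f x)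
      ≡⟨ cong (_+ sumCube (λ x → not (E x j) ⊙ f x)) (sumCube-edge-flip j (λ _ z → f z)) ⟩
    sumCube (λ x → E x j ⊙ f x) + sumCube (λ x → not (E x j) ⊙ f x)
      ≡⟨ sumBy-+ (allVertices n) _ _ ⟨
    sumCube (λ x → E x j ⊙ f x + not (E x j) ⊙ f x)
      ≡⟨ sumBy-cong (allVertices n) (λ x → ⊙-split (E x j) (f x)) ⟩
    sumCube f
      ∎

  geodesicSum : ℕ → Dirs n → (Vertex n → ℕ) → Vertex n → ℕ
  geodesicSum zero    A φ x = V x ⊙ φ x
  geodesicSum (suc k) A φ x = sumFin (λ j → (A j ∧ E x j) ⊙ geodesicSum k (A ─ j) φ (flipAt j x))

  geodesicSum-cong : ∀ k {A B : Dirs n} {φ ψ : Vertex n → ℕ}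
    → (∀ i → A i ≡ B i) → (∀ z → φ z ≡ ψ z) → ∀ x → geodesicSum k A φ x ≡ geodesicSum k B ψ x
  geodesicSum-cong zero    A≗B φ≗ψ x = cong (V x ⊙_) (φ≗ψ x)
  geodesicSum-cong (suc k) A≗B φ≗ψ x = sumFin-cong λ j →
    cong₂ (λ a w → (a ∧ E x j) ⊙ w) (A≗B j)
      (geodesicSum-cong k (λ i → cong (_∧ not (i ≟ᵇ j)) (A≗B i)) φ≗ψ (flipAt j x))

  geodesicSum-⊙ : ∀ k A φ c x → c ⊙ geodesicSum k A φ x ≡ geodesicSum k A (λ z → c ⊙ φ z) x
  geodesicSum-⊙ zero    A φ c x = ⊙-comm c (V x) (φ x)
  geodesicSum-⊙ (suc k) A φ c x =
    trans (⊙-sumFin c (λ j → (A j ∧ E x j) ⊙ geodesicSum k (A ─ j) φ (flipAt j x))) (sumFin-cong λ j →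
      trans (⊙-comm c (A j ∧ E x j) _) (cong ((A j ∧ E x j) ⊙_) (geodesicSum-⊙ k (A ─ j) φ c (flipAt j x))))

  geodesicSum-+ : ∀ k A φ ψ x
    → geodesicSum k A (λ z → φ z + ψ z) x ≡ geodesicSum k A φ x + geodesicSum k A ψ x
  geodesicSum-+ zero    A φ ψ x = ⊙-+ (V x) (φ x) (ψ x)
  geodesicSum-+ (suc k) A φ ψ x = trans (sumFin-cong λ j →
      trans (cong ((A j ∧ E x j) ⊙_) (geodesicSum-+ k (A ─ j) φ ψ (flipAt j x))) (⊙-+ (A j ∧ E x j) _ _))
    (sumFin-+ (λ j → (A j ∧ E x j) ⊙ geodesicSum k (A ─ j) φ (flipAt j x))
              (λ j → (A j ∧ E x j) ⊙ geodesicSum k (A ─ j) ψ (flipAt j x)))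

  geodesicSum-mono : ∀ k A {φ ψ}
    → (∀ z → φ z ≤ ψ z) → ∀ x → geodesicSum k A φ x ≤ geodesicSum k A ψ x
  geodesicSum-mono zero    A φ≤ψ x = ⊙-monoʳ-≤ (V x) (φ≤ψ x)
  geodesicSum-mono (suc k) A φ≤ψ x = sumFin-mono λ j →
    ⊙-monoʳ-≤ (A j ∧ E x j) (geodesicSum-mono k (A ─ j) φ≤ψ (flipAt j x))

  geodesicSum-last : ∀ k A φ y
    → geodesicSum (suc k) A φ y
    ≡ sumFin (λ j → A j ⊙ geodesicSum k (A ─ j) (λ z → E z j ⊙ φ (flipAt j z)) y)
  geodesicSum-last zero A φ y = sumFin-cong last-edge
    where
    last-edge : ∀ j
      → (A j ∧ E y j) ⊙ V (flipAt j y) ⊙ φ (flipAt j y) ≡ A j ⊙ V y ⊙ E y j ⊙ φ (flipAt j y)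
    last-edge j with A j | E y j in Eyj
    ... | false | _     = refl
    ... | true  | false = sym (⊙-comm (V y) false (φ (flipAt j y)))
    ... | true  | true  rewrite E⇒V y j Eyj | E⇒V-flip y j Eyj = refl
  geodesicSum-last (suc k) A φ y = begin-equality
    sumFin (λ i → (A i ∧ E y i) ⊙ geodesicSum (suc k) (A ─ i) φ (flipAt i y))
      ≡⟨ sumFin-cong (λ i → cong ((A i ∧ E y i) ⊙_) (geodesicSum-last k (A ─ i) φ (flipAt i y))) ⟩
    sumFin (λ i → (A i ∧ E y i) ⊙ sumFin (λ j → (A ─ i) j ⊙ geodesicSum k (A ─ i ─ j) (φ′ j) (flipAt i y)))
      ≡⟨ sumFin-exchange A (E y) (λ i j B → geodesicSum k B (φ′ j) (flipAt i y))
           (λ i j B≗C → geodesicSum-cong k B≗C (λ _ → refl) (flipAt i y)) ⟩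
    sumFin (λ j → A j ⊙ geodesicSum (suc k) (A ─ j) (φ′ j) y)
      ∎
    where
    φ′ : Fin n → Vertex n → ℕ
    φ′ j z = E z j ⊙ φ (flipAt j z)

  geodesicSum-reverse : ∀ k A (ψ : Vertex n → Vertex n → ℕ)
    → sumCube (λ x → geodesicSum k A (ψ x) x) ≡ sumCube (λ x → geodesicSum k A (λ z → ψ z x) x)
  geodesicSum-reverse zero    A ψ = refl
  geodesicSum-reverse (suc k) A ψ = begin-equality
    sumCube (λ x → sumFin (λ j → (A j ∧ E x j) ⊙ geodesicSum k (A ─ j) (ψ x) (flipAt j x)))
      ≡⟨ sumBy-comm (allVertices n) (allFin n) _ ⟩
    sumFin (λ j → sumCube (λ x → (A j ∧ E x j) ⊙ geodesicSum k (A ─ j) (ψ x) (flipAt j x)))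
      ≡⟨ sumFin-cong first-edge-reversed ⟩
    sumFin (λ j → A j ⊙ sumCube (λ y → geodesicSum k (A ─ j) (ψ′ j y) y))
      ≡⟨ sumFin-cong (λ j → ⊙-sumBy (A j) (allVertices n) (λ y → geodesicSum k (A ─ j) (ψ′ j y) y)) ⟩
    sumFin (λ j → sumCube (λ y → A j ⊙ geodesicSum k (A ─ j) (ψ′ j y) y))
      ≡⟨ sumBy-comm (allFin n) (allVertices n) _ ⟩
    sumCube (λ y → sumFin (λ j → A j ⊙ geodesicSum k (A ─ j) (ψ′ j y) y))
      ≡⟨ sumBy-cong (allVertices n) (λ y → sym (geodesicSum-last k A (λ z → ψ z y) y)) ⟩
    sumCube (λ y → geodesicSum (suc k) A (λ z → ψ z y) y)
      ∎
    where
    ψ′ : Fin n → Vertex n → Vertex n → ℕ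
    ψ′ j y z = E z j ⊙ ψ (flipAt j z) y
    first-edge-reversed : ∀ j → sumCube (λ x → (A j ∧ E x j) ⊙ geodesicSum k (A ─ j) (ψ x) (flipAt j x))
                              ≡ A j ⊙ sumCube (λ y → geodesicSum k (A ─ j) (ψ′ j y) y)
    first-edge-reversed j = begin-equality
      sumCube (λ x → (A j ∧ E x j) ⊙ geodesicSum k (A ─ j) (ψ x) (flipAt j x))
        ≡⟨ sumBy-cong (allVertices n) (λ x → ⊙-∧ (A j) (E x j) _) ⟩
      sumCube (λ x → A j ⊙ E x j ⊙ geodesicSum k (A ─ j) (ψ x) (flipAt j x))
        ≡⟨ ⊙-sumBy (A j) (allVertices n) _ ⟨
      A j ⊙ sumCube (λ x → E x j ⊙ geodesicSum k (A ─ j) (ψ x) (flipAt j x))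
        ≡⟨ cong (A j ⊙_) (sumCube-edge-flip j (λ x y → geodesicSum k (A ─ j) (ψ x) y)) ⟩
      A j ⊙ sumCube (λ y → E y j ⊙ geodesicSum k (A ─ j) (ψ (flipAt j y)) y)
        ≡⟨ cong (A j ⊙_) (sumBy-cong (allVertices n) λ y →
             geodesicSum-⊙ k (A ─ j) (ψ (flipAt j y)) (E y j) y) ⟩
      A j ⊙ sumCube (λ y → geodesicSum k (A ─ j) (λ z → E y j ⊙ ψ (flipAt j y) z) y)
        ≡⟨ cong (A j ⊙_) (geodesicSum-reverse k (A ─ j) (λ y z → E y j ⊙ ψ (flipAt j y) z)) ⟩
      A j ⊙ sumCube (λ y → geodesicSum k (A ─ j) (ψ′ j y) y)
        ∎

  walkInG-∷ : ∀ {k} x i (s : Vec (Fin n) k) → walkInG V E x (i ∷ s) ≡ E x i ∧ walkInG V E (flipAt i x) s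
  walkInG-∷ x i s with E x i in Exi
  ... | true  rewrite E⇒V x i Exi = refl
  ... | false = ∧-zeroʳ (V x)

  geodesicSum-enumeration : ∀ k A φ x
    → sumBy (allDirSeqs n k) (λ s → (allIn A s ∧ distinctDirs s ∧ walkInG V E x s) ⊙ φ (walkEnd x s))
    ≡ geodesicSum k A φ x
  geodesicSum-enumeration zero    A φ x = +-identityʳ _
  geodesicSum-enumeration (suc k) A φ x = begin-equality
    sumBy (concatMap (λ s → List.map (_∷ s) (allFin n)) (allDirSeqs n k)) term
      ≡⟨ sumBy-concatMap _ (allDirSeqs n k) term ⟩
    sumBy (allDirSeqs n k) (λ s → sumBy (List.map (_∷ s) (allFin n)) term)
      ≡⟨ sumBy-cong (allDirSeqs n k) (λ s → sumBy-map (_∷ s) (allFin n) term) ⟩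
    sumBy (allDirSeqs n k) (λ s → sumFin (λ i → term (i ∷ s)))
      ≡⟨ sumBy-comm (allDirSeqs n k) (allFin n) _ ⟩
    sumFin (λ i → sumBy (allDirSeqs n k) (λ s → term (i ∷ s)))
      ≡⟨ sumFin-cong (λ i → sumBy-cong (allDirSeqs n k) (first-step i)) ⟩
    sumFin (λ i → sumBy (allDirSeqs n k) (λ s → (A i ∧ E x i) ⊙ term′ i s))
      ≡⟨ sumFin-cong (λ i → sym (⊙-sumBy (A i ∧ E x i) (allDirSeqs n k) (term′ i))) ⟩
    sumFin (λ i → (A i ∧ E x i) ⊙ sumBy (allDirSeqs n k) (term′ i))
      ≡⟨ sumFin-cong (λ i → cong ((A i ∧ E x i) ⊙_) (geodesicSum-enumeration k (A ─ i) φ (flipAt i x))) ⟩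
    geodesicSum (suc k) A φ x
      ∎
    where
    term : Vec (Fin n) (suc k) → ℕ
    term s = (allIn A s ∧ distinctDirs s ∧ walkInG V E x s) ⊙ φ (walkEnd x s)
    term′ : Fin n → Vec (Fin n) k → ℕ
    term′ i s = (allIn (A ─ i) s ∧ distinctDirs s ∧ walkInG V E (flipAt i x) s) ⊙ φ (walkEnd (flipAt i x) s)
    shuffle : ∀ a b m d e w t → ((a ∧ b) ∧ (m ∧ d) ∧ (e ∧ w)) ⊙ t ≡ (a ∧ e) ⊙ ((b ∧ m) ∧ d ∧ w) ⊙ t
    shuffle false b m d e     w t = refl
    shuffle true  b m d true  w t = cong (_⊙ t) (trans (cong (b ∧_) (∧-assoc m d w)) (sym (∧-assoc b m (d ∧ w))))
    shuffle true  b m d false w t = cong (_⊙ t) (trans (cong (b ∧_) (∧-zeroʳ (m ∧ d))) (∧-zeroʳ b))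
    first-step : ∀ i s → term (i ∷ s) ≡ (A i ∧ E x i) ⊙ term′ i s
    first-step i s = begin-equality
      term (i ∷ s)
        ≡⟨ cong₂ (λ d w → ((A i ∧ allIn A s) ∧ d ∧ w) ⊙ t) (distinctDirs-∷ i s) (walkInG-∷ x i s) ⟩
      ((A i ∧ allIn A s) ∧ (not (i ∈ᵇ s) ∧ distinctDirs s) ∧ (E x i ∧ w)) ⊙ t
        ≡⟨ shuffle (A i) (allIn A s) (not (i ∈ᵇ s)) (distinctDirs s) (E x i) w t ⟩
      (A i ∧ E x i) ⊙ ((allIn A s ∧ not (i ∈ᵇ s)) ∧ distinctDirs s ∧ w) ⊙ t
        ≡⟨ cong (λ a → (A i ∧ E x i) ⊙ (a ∧ distinctDirs s ∧ w) ⊙ t) (allIn-─ A i s) ⟨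
      (A i ∧ E x i) ⊙ term′ i s
        ∎
      where
      w = walkInG V E (flipAt i x) s
      t = φ (walkEnd (flipAt i x) s)

  geodesics : ℕ → Dirs n → Vertex n → ℕ
  geodesics k A = geodesicSum k A (λ _ → 1)

  geodesicCount-≡ : ∀ d → geodesicCount V E d ≡ sumCube (λ x → geodesicSum d allDirs (λ z → lexLeq x z ⊙ 1) x)
  geodesicCount-≡ d = sumBy-cong (allVertices n) λ x →
    trans (sumBy-cong (allDirSeqs n d) (canonical x)) (geodesicSum-enumeration d allDirs (λ z → lexLeq x z ⊙ 1) x)
    where
    canonical : ∀ x s → isCanonicalGeodesic V E x s ⊙ 1
                      ≡ (allIn allDirs s ∧ distinctDirs s ∧ walkInG V E x s) ⊙ lexLeq x (walkEnd x s) ⊙ 1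
    canonical x s rewrite allIn-allDirs s =
      trans (cong (_⊙ 1) (sym (∧-assoc (distinctDirs s) (walkInG V E x s) _)))
            (⊙-∧ (distinctDirs s ∧ walkInG V E x s) (lexLeq x (walkEnd x s)) 1)

  -- Reversal maps the walks with start ≰ end injectively onto those with start ≤ end.
  geodesics≤2*geodesicCount : ∀ d → sumCube (geodesics d allDirs) ≤ 2 * geodesicCount V E d
  geodesics≤2*geodesicCount d rewrite geodesicCount-≡ d = begin
    sumCube (geodesics d allDirs)
      ≡⟨ sumBy-cong (allVertices n) (λ x →
           trans (geodesicSum-cong d (λ _ → refl) (λ z → sym (⊙-split (lexLeq x z) 1)) x)
                 (geodesicSum-+ d allDirs _ _ x)) ⟩
    sumCube (λ x → forward x + backward x)
      ≡⟨ sumBy-+ (allVertices n) forward backward ⟩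
    sumCube forward + sumCube backward
      ≤⟨ +-monoʳ-≤ (sumCube forward) (sumBy-mono (allVertices n) λ x →
           geodesicSum-mono d allDirs (λ z → reversed-≤ x z) x) ⟩
    sumCube forward + sumCube (λ x → geodesicSum d allDirs (λ z → lexLeq z x ⊙ 1) x)
      ≡⟨ cong (sumCube forward +_) (geodesicSum-reverse d allDirs (λ x z → lexLeq z x ⊙ 1)) ⟩
    sumCube forward + sumCube forward
      ≡⟨ cong (sumCube forward +_) (sym (+-identityʳ _)) ⟩
    2 * sumCube forward
      ∎
    where
    forward backward : Vertex n → ℕ
    forward  x = geodesicSum d allDirs (λ z → lexLeq x z ⊙ 1) x
    backward x = geodesicSum d allDirs (λ z → not (lexLeq x z) ⊙ 1) x
    reversed-≤ : ∀ x z → not (lexLeq x z) ⊙ 1 ≤ lexLeq z x ⊙ 1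
    reversed-≤ x z with lexLeq x z in x≤z
    ... | true  = z≤n
    ... | false rewrite lexLeq-total x z x≤z = ≤-refl

  -- The walkers

  -- The number of steps of the walker starting at x when the directions of L are processed in order.
  greedyLength : List (Fin n) → Vertex n → ℕ
  greedyLength []      x = 0
  greedyLength (j ∷ L) x = if E x j then suc (greedyLength L (flipAt j x)) else greedyLength L x

  -- Walks in G whose direction sequence is a subsequence of L.
  monotoneWalks : ℕ → List (Fin n) → Vertex n → ℕ
  monotoneWalks zero    L       x = V x ⊙ 1
  monotoneWalks (suc k) []      x = 0
  monotoneWalks (suc k) (j ∷ L) x = monotoneWalks (suc k) L x + E x j ⊙ monotoneWalks k L (flipAt j x)

  degree : Fin n → ℕ
  degree j = sumCube (λ x → E x j ⊙ 1)

  sumCube-greedyLength : ∀ L → sumCube (greedyLength L) ≡ sumBy L degree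
  sumCube-greedyLength []      = sumBy-zero (allVertices n)
  sumCube-greedyLength (j ∷ L) = begin-equality
    sumCube (greedyLength (j ∷ L))
      ≡⟨ sumBy-cong (allVertices n) (λ x → count-edge (E x j)) ⟩
    sumCube (λ x → E x j ⊙ 1 + (if E x j then greedyLength L (flipAt j x) else greedyLength L x))
      ≡⟨ sumBy-+ (allVertices n) _ _ ⟩
    degree j + sumCube (λ x → if E x j then greedyLength L (flipAt j x) else greedyLength L x)
      ≡⟨ cong (degree j +_) (sumCube-swap-along j (greedyLength L)) ⟩
    degree j + sumCube (greedyLength L)
      ≡⟨ cong (degree j +_) (sumCube-greedyLength L) ⟩
    degree j + sumBy L degree
      ∎
    where
    count-edge : ∀ {s t} b → (if b then suc s else t) ≡ b ⊙ 1 + (if b then s else t)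
    count-edge true  = refl
    count-edge false = refl

  greedyLength-outside : ∀ L x → V x ≡ false → greedyLength L x ≡ 0
  greedyLength-outside []      x _   = refl
  greedyLength-outside (j ∷ L) x ¬Vx with E x j in Exj
  ... | true  = contradiction (trans (sym ¬Vx) (E⇒V x j Exj)) λ ()
  ... | false = greedyLength-outside L x ¬Vx

  monotoneWalks-prefix : ∀ k L y → V y ≡ true → k ≤ greedyLength L y → 1 ≤ monotoneWalks k L y
  monotoneWalks-prefix zero    L       y Vy _ rewrite Vy = ≤-refl
  monotoneWalks-prefix (suc k) []      y Vy ()
  monotoneWalks-prefix (suc k) (j ∷ L) y Vy k<g with E y j in Eyj
  ... | true  = ≤-trans (monotoneWalks-prefix k L (flipAt j y) (E⇒V-flip y j Eyj) (s≤s⁻¹ k<g))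
                        (m≤n+m _ (monotoneWalks (suc k) L y))
  ... | false = ≤-trans (monotoneWalks-prefix (suc k) L y Vy k<g) (m≤m+n _ 0)

  greedyLength-suc-∸ : ∀ k L y → V y ≡ true
    → suc (greedyLength L y) ∸ k ≤ (greedyLength L y ∸ k) + monotoneWalks k L y
  greedyLength-suc-∸ k L y Vy with k ≤? greedyLength L y
  ... | yes k≤g = begin
    suc (greedyLength L y) ∸ k             ≡⟨ +-∸-assoc 1 k≤g ⟩
    suc (greedyLength L y ∸ k)             ≡⟨ +-comm 1 _ ⟩
    (greedyLength L y ∸ k) + 1             ≤⟨ +-monoʳ-≤ _ (monotoneWalks-prefix k L y Vy k≤g) ⟩
    (greedyLength L y ∸ k) + monotoneWalks k L y ∎
  ... | no  k≰g = ≤-trans (≤-reflexive (m≤n⇒m∸n≡0 (≰⇒> k≰g))) z≤n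

  -- The stretches of length d + 1 of the walkers' walks are distinct monotone walks.
  sumCube-greedyLength-∸ : ∀ d L → sumCube (λ x → greedyLength L x ∸ d) ≤ sumCube (monotoneWalks (suc d) L)
  sumCube-greedyLength-∸ d []      = sumBy-mono (allVertices n) (λ _ → ≤-reflexive (0∸n≡0 d))
  sumCube-greedyLength-∸ d (j ∷ L) = begin
    sumCube (λ x → greedyLength (j ∷ L) x ∸ d)
      ≤⟨ sumBy-mono (allVertices n) (λ x → walker-step x (E x j) refl) ⟩
    sumCube (λ x → tail x + edge x)
      ≡⟨ sumBy-+ (allVertices n) tail edge ⟩
    sumCube tail + sumCube edge
      ≡⟨ cong (_+ sumCube edge) (sumCube-swap-along j (λ x → greedyLength L x ∸ d)) ⟩
    sumCube (λ x → greedyLength L x ∸ d) + sumCube edge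
      ≤⟨ +-monoˡ-≤ (sumCube edge) (sumCube-greedyLength-∸ d L) ⟩
    sumCube (monotoneWalks (suc d) L) + sumCube edge
      ≡⟨ sumBy-+ (allVertices n) (monotoneWalks (suc d) L) edge ⟨
    sumCube (monotoneWalks (suc d) (j ∷ L))
      ∎
    where
    tail : Vertex n → ℕ
    tail x = if E x j then greedyLength L (flipAt j x) ∸ d else greedyLength L x ∸ d
    edge : Vertex n → ℕ
    edge x = E x j ⊙ monotoneWalks d L (flipAt j x)
    walker-step : ∀ x b → E x j ≡ b
      → greedyLength (j ∷ L) x ∸ d ≤ tail x + edge x
    walker-step x true  Exj rewrite Exj = greedyLength-suc-∸ d L (flipAt j x) (E⇒V-flip x j Exj)
    walker-step x false Exj rewrite Exj = m≤m+n _ 0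

  sumBy-degree≤ : ∀ d L → sumBy L degree ≤ sumCube (monotoneWalks (suc d) L) + d * vertexCount V
  sumBy-degree≤ d L = begin
    sumBy L degree
      ≡⟨ sumCube-greedyLength L ⟨
    sumCube (greedyLength L)
      ≤⟨ sumBy-mono (allVertices n) (λ x → split x (V x) refl) ⟩
    sumCube (λ x → (greedyLength L x ∸ d) + d * (V x ⊙ 1))
      ≡⟨ sumBy-+ (allVertices n) _ _ ⟩
    sumCube (λ x → greedyLength L x ∸ d) + sumCube (λ x → d * (V x ⊙ 1))
      ≡⟨ cong (sumCube (λ x → greedyLength L x ∸ d) +_) (sumBy-*ˡ (allVertices n) d (λ x → V x ⊙ 1)) ⟩
    sumCube (λ x → greedyLength L x ∸ d) + d * vertexCount V
      ≤⟨ +-monoˡ-≤ _ (sumCube-greedyLength-∸ d L) ⟩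
    sumCube (monotoneWalks (suc d) L) + d * vertexCount V
      ∎
    where
    split : ∀ x b → V x ≡ b → greedyLength L x ≤ (greedyLength L x ∸ d) + d * (V x ⊙ 1)
    split x true  Vx rewrite Vx = begin
      greedyLength L x                  ≤⟨ m≤n+m∸n _ d ⟩
      d + (greedyLength L x ∸ d)        ≡⟨ +-comm d _ ⟩
      (greedyLength L x ∸ d) + d        ≡⟨ cong ((greedyLength L x ∸ d) +_) (*-identityʳ d) ⟨
      (greedyLength L x ∸ d) + d * 1    ∎
    split x false Vx rewrite Vx | greedyLength-outside L x Vx = z≤n

  -- Averaging over the orderings

  -- A geodesic of length k with directions in A avoids exactly size A ∸ k of the directions of A.
  sumFin-geodesics-─ : ∀ k A x
    → sumFin (λ j → A j ⊙ geodesics k (A ─ j) x) + k * geodesics k A x ≡ size A * geodesics k A x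
  sumFin-geodesics-─ zero    A x = trans (+-identityʳ _) (sumFin-⊙-const A (V x ⊙ 1))
  sumFin-geodesics-─ (suc k) A x = begin-equality
    sumFin (λ j → A j ⊙ geodesics (suc k) (A ─ j) x) + suc k * geodesics (suc k) A x
      ≡⟨ cong₂ _+_ (sym (sumFin-exchange A (E x) (λ i _ B → geodesics k B (flipAt i x))
                          (λ i _ B≗C → geodesicSum-cong k B≗C (λ _ → refl) (flipAt i x))))
                   (trans (sym (sumFin-*ˡ (suc k) (λ i → (A i ∧ E x i) ⊙ N i)))
                          (sumFin-cong (λ i → sym (⊙-*ˡ (A i ∧ E x i) (suc k) (N i))))) ⟩
    sumFin (λ i → (A i ∧ E x i) ⊙ R i) + sumFin (λ i → (A i ∧ E x i) ⊙ (suc k * N i))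
      ≡⟨ sumFin-+ (λ i → (A i ∧ E x i) ⊙ R i) (λ i → (A i ∧ E x i) ⊙ (suc k * N i)) ⟨
    sumFin (λ i → (A i ∧ E x i) ⊙ R i + (A i ∧ E x i) ⊙ (suc k * N i))
      ≡⟨ sumFin-cong (λ i → sym (⊙-+ (A i ∧ E x i) (R i) (suc k * N i))) ⟩
    sumFin (λ i → (A i ∧ E x i) ⊙ (R i + suc k * N i))
      ≡⟨ sumFin-cong (λ i → ⊙-∧ (A i) (E x i) _) ⟩
    sumFin (λ i → A i ⊙ E x i ⊙ (R i + suc k * N i))
      ≡⟨ sumFin-⊙-cong A (λ i Ai → cong (E x i ⊙_) (count i Ai)) ⟩
    sumFin (λ i → A i ⊙ E x i ⊙ (size A * N i))
      ≡⟨ sumFin-cong (λ i → trans (sym (⊙-∧ (A i) (E x i) _)) (⊙-*ˡ (A i ∧ E x i) (size A) (N i))) ⟩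
    sumFin (λ i → size A * ((A i ∧ E x i) ⊙ N i))
      ≡⟨ sumFin-*ˡ (size A) (λ i → (A i ∧ E x i) ⊙ N i) ⟩
    size A * geodesics (suc k) A x
      ∎
    where
    N R : Fin n → ℕ
    N i = geodesics k (A ─ i) (flipAt i x)
    R i = sumFin (λ j → (A ─ i) j ⊙ geodesics k (A ─ i ─ j) (flipAt i x))
    count : ∀ i → A i ≡ true → R i + suc k * N i ≡ size A * N i
    count i Ai = begin-equality
      R i + (N i + k * N i)            ≡⟨ +.x∙yz≈y∙xz (R i) (N i) (k * N i) ⟩
      N i + (R i + k * N i)            ≡⟨ cong (N i +_) (sumFin-geodesics-─ k (A ─ i) (flipAt i x)) ⟩
      N i + size (A ─ i) * N i         ≡⟨ cong (_* N i) (size-─ A Ai) ⟨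
      size A * N i                     ∎

  sumFin-geodesics-recurrence : ∀ m k A x → size A ≡ suc m
    → sumFin (λ j → A j ⊙ (m ! * geodesics (suc k) (A ─ j) x
                           + E x j ⊙ (suc k * (m ! * geodesics k (A ─ j) (flipAt j x)))))
    ≡ suc m ! * geodesics (suc k) A x
  sumFin-geodesics-recurrence m k A x |A|≡1+m = begin-equality
    sumFin (λ j → A j ⊙ (m ! * G₁ j + E x j ⊙ (suc k * (m ! * G₀ j))))
      ≡⟨ sumFin-cong (λ j → regroup (A j) (E x j) (G₁ j) (G₀ j)) ⟩
    sumFin (λ j → m ! * (A j ⊙ G₁ j) + (suc k * m !) * ((A j ∧ E x j) ⊙ G₀ j))
      ≡⟨ sumFin-+ (λ j → m ! * (A j ⊙ G₁ j)) (λ j → (suc k * m !) * ((A j ∧ E x j) ⊙ G₀ j)) ⟩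
    sumFin (λ j → m ! * (A j ⊙ G₁ j)) + sumFin (λ j → (suc k * m !) * ((A j ∧ E x j) ⊙ G₀ j))
      ≡⟨ cong₂ _+_ (sumFin-*ˡ (m !) (λ j → A j ⊙ G₁ j))
                   (sumFin-*ˡ (suc k * m !) (λ j → (A j ∧ E x j) ⊙ G₀ j)) ⟩
    m ! * sumFin (λ j → A j ⊙ G₁ j) + (suc k * m !) * geodesics (suc k) A x
      ≡⟨ factor (m !) (sumFin (λ j → A j ⊙ G₁ j)) (suc k) (geodesics (suc k) A x) ⟩
    m ! * (sumFin (λ j → A j ⊙ G₁ j) + suc k * geodesics (suc k) A x)
      ≡⟨ cong (m ! *_) (sumFin-geodesics-─ (suc k) A x) ⟩
    m ! * (size A * geodesics (suc k) A x)
      ≡⟨ cong (λ s → m ! * (s * geodesics (suc k) A x)) |A|≡1+m ⟩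
    m ! * (suc m * geodesics (suc k) A x)
      ≡⟨ reassociate (m !) (suc m) (geodesics (suc k) A x) ⟩
    suc m ! * geodesics (suc k) A x
      ∎
    where
    G₁ G₀ : Fin n → ℕ
    G₁ j = geodesics (suc k) (A ─ j) x
    G₀ j = geodesics k (A ─ j) (flipAt j x)
    regroup : ∀ a e g₁ g₀
      → a ⊙ (m ! * g₁ + e ⊙ (suc k * (m ! * g₀))) ≡ m ! * (a ⊙ g₁) + (suc k * m !) * ((a ∧ e) ⊙ g₀)
    regroup a e g₁ g₀ = begin-equality
      a ⊙ (m ! * g₁ + e ⊙ (suc k * (m ! * g₀)))
        ≡⟨ ⊙-+ a _ _ ⟩
      a ⊙ (m ! * g₁) + a ⊙ e ⊙ (suc k * (m ! * g₀))
        ≡⟨ cong₂ _+_ (⊙-*ˡ a (m !) g₁) (sym (⊙-∧ a e _)) ⟩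
      m ! * (a ⊙ g₁) + (a ∧ e) ⊙ (suc k * (m ! * g₀))
        ≡⟨ cong (λ t → m ! * (a ⊙ g₁) + (a ∧ e) ⊙ t) (*-assoc (suc k) (m !) g₀) ⟨
      m ! * (a ⊙ g₁) + (a ∧ e) ⊙ (suc k * m ! * g₀)
        ≡⟨ cong (m ! * (a ⊙ g₁) +_) (⊙-*ˡ (a ∧ e) (suc k * m !) g₀) ⟩
      m ! * (a ⊙ g₁) + (suc k * m !) * ((a ∧ e) ⊙ g₀)
        ∎
    factor : ∀ a s c w → a * s + (c * a) * w ≡ a * (s + c * w)
    factor = solve-∀
    reassociate : ∀ a b w → a * (b * w) ≡ (b * a) * w
    reassociate = solve-∀

  -- Each geodesic of length d with directions in A is monotone for a d!-th of the orderings of A.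
  sumBy-orderings-monotoneWalks : ∀ m d A x → size A ≡ m
    → d ! * sumBy (orderings m A) (λ L → monotoneWalks d L x) ≤ m ! * geodesics d A x
  sumBy-orderings-monotoneWalks m zero A x |A|≡m =
    ≤-reflexive (trans (*-identityˡ _) (sumBy-orderings-const m A (V x ⊙ 1) |A|≡m))
  sumBy-orderings-monotoneWalks zero (suc d) A x _ = ≤-trans (≤-reflexive (*-zeroʳ (suc d !))) z≤n
  sumBy-orderings-monotoneWalks (suc m) (suc d) A x |A|≡1+m = begin
    suc d ! * sumBy (orderings (suc m) A) (λ L → monotoneWalks (suc d) L x)
      ≡⟨ cong (suc d ! *_) (sumBy-orderings m A (λ L → monotoneWalks (suc d) L x)) ⟩
    suc d ! * sumFin T
      ≡⟨ sumFin-*ˡ (suc d !) T ⟨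
    sumFin (λ j → suc d ! * T j)
      ≡⟨ sumFin-cong distribute ⟩
    sumFin (λ j → A j ⊙ (suc d ! * S₁ j + E x j ⊙ (suc d * (d ! * S₀ j))))
      ≤⟨ sumFin-⊙-mono A (λ j Aj → +-mono-≤
           (sumBy-orderings-monotoneWalks m (suc d) (A ─ j) x (size-─-pred A |A|≡1+m Aj))
           (⊙-monoʳ-≤ (E x j) (*-monoʳ-≤ (suc d)
             (sumBy-orderings-monotoneWalks m d (A ─ j) (flipAt j x) (size-─-pred A |A|≡1+m Aj))))) ⟩
    sumFin (λ j → A j ⊙ (m ! * geodesics (suc d) (A ─ j) x
                         + E x j ⊙ (suc d * (m ! * geodesics d (A ─ j) (flipAt j x)))))
      ≡⟨ sumFin-geodesics-recurrence m d A x |A|≡1+m ⟩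
    suc m ! * geodesics (suc d) A x
      ∎
    where
    O : Fin n → List (List (Fin n))
    O j = orderings m (A ─ j)
    T S₁ S₀ : Fin n → ℕ
    T j = A j ⊙ sumBy (O j) (λ L → monotoneWalks (suc d) L x + E x j ⊙ monotoneWalks d L (flipAt j x))
    S₁ j = sumBy (O j) (λ L → monotoneWalks (suc d) L x)
    S₀ j = sumBy (O j) (λ L → monotoneWalks d L (flipAt j x))
    distribute : ∀ j → suc d ! * T j ≡ A j ⊙ (suc d ! * S₁ j + E x j ⊙ (suc d * (d ! * S₀ j)))
    distribute j = begin-equality
      suc d ! * T j
        ≡⟨ ⊙-*ˡ (A j) (suc d !) _ ⟨
      A j ⊙ (suc d ! * sumBy (O j) (λ L → monotoneWalks (suc d) L x + E x j ⊙ monotoneWalks d L (flipAt j x)))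
        ≡⟨ cong (λ t → A j ⊙ (suc d ! * t)) (sumBy-+ (O j) _ _) ⟩
      A j ⊙ (suc d ! * (S₁ j + sumBy (O j) (λ L → E x j ⊙ monotoneWalks d L (flipAt j x))))
        ≡⟨ cong (λ t → A j ⊙ (suc d ! * (S₁ j + t))) (⊙-sumBy (E x j) (O j) _) ⟨
      A j ⊙ (suc d ! * (S₁ j + E x j ⊙ S₀ j))
        ≡⟨ cong (A j ⊙_) (*-distribˡ-+ (suc d !) (S₁ j) _) ⟩
      A j ⊙ (suc d ! * S₁ j + suc d ! * (E x j ⊙ S₀ j))
        ≡⟨ cong (λ t → A j ⊙ (suc d ! * S₁ j + t)) (⊙-*ˡ (E x j) (suc d !) (S₀ j)) ⟨
      A j ⊙ (suc d ! * S₁ j + E x j ⊙ (suc d ! * S₀ j))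
        ≡⟨ cong (λ t → A j ⊙ (suc d ! * S₁ j + E x j ⊙ t)) (*-assoc (suc d) (d !) (S₀ j)) ⟩
      A j ⊙ (suc d ! * S₁ j + E x j ⊙ (suc d * (d ! * S₀ j)))
        ∎

  sumFin-degree : sumFin degree ≡ degreeSum V E
  sumFin-degree = sumBy-comm (allFin n) (allVertices n) (λ j x → E x j ⊙ 1)

  n!*degreeSum≤ : ∀ d → n ! * degreeSum V E
    ≤ sumBy (allOrderings n) (λ L → sumCube (monotoneWalks (suc d) L)) + n ! * (d * vertexCount V)
  n!*degreeSum≤ d = begin
    n ! * degreeSum V E
      ≡⟨ cong (n ! *_) sumFin-degree ⟨
    n ! * sumFin degree
      ≡⟨ sumBy-orderings-sumBy n allDirs degree (size-allDirs n) ⟨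
    sumBy (allOrderings n) (λ L → sumBy L degree)
      ≤⟨ sumBy-mono (allOrderings n) (sumBy-degree≤ d) ⟩
    sumBy (allOrderings n) (λ L → M L + d * vertexCount V)
      ≡⟨ sumBy-+ (allOrderings n) M (λ _ → d * vertexCount V) ⟩
    sumBy (allOrderings n) M + sumBy (allOrderings n) (λ _ → d * vertexCount V)
      ≡⟨ cong (sumBy (allOrderings n) M +_)
              (sumBy-orderings-const n allDirs (d * vertexCount V) (size-allDirs n)) ⟩
    sumBy (allOrderings n) M + n ! * (d * vertexCount V)
      ∎
    where
    M : List (Fin n) → ℕ
    M L = sumCube (monotoneWalks (suc d) L)

  sumBy-allOrderings-sumCube-monotoneWalks : ∀ d
    → d ! * sumBy (allOrderings n) (λ L → sumCube (monotoneWalks d L)) ≤ n ! * sumCube (geodesics d allDirs)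
  sumBy-allOrderings-sumCube-monotoneWalks d = begin
    d ! * sumBy (allOrderings n) (λ L → sumCube (monotoneWalks d L))
      ≡⟨ cong (d ! *_) (sumBy-comm (allOrderings n) (allVertices n) (λ L x → monotoneWalks d L x)) ⟩
    d ! * sumCube (λ x → sumBy (allOrderings n) (λ L → monotoneWalks d L x))
      ≡⟨ sumBy-*ˡ (allVertices n) (d !) _ ⟨
    sumCube (λ x → d ! * sumBy (allOrderings n) (λ L → monotoneWalks d L x))
      ≤⟨ sumBy-mono (allVertices n) (λ x → sumBy-orderings-monotoneWalks n d allDirs x (size-allDirs n)) ⟩
    sumCube (λ x → n ! * geodesics d allDirs x)
      ≡⟨ sumBy-*ˡ (allVertices n) (n !) _ ⟩
    n ! * sumCube (geodesics d allDirs)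
      ∎

  geodesics-lower-bound : ∀ d → d * vertexCount V ≤ degreeSum V E
    → d ! * vertexCount V ≤ sumCube (geodesics d allDirs)
  geodesics-lower-bound zero    _   = ≤-reflexive (*-identityˡ _)
  geodesics-lower-bound (suc d) avg = *-cancelˡ-≤ (n !) {{n !≢0}} (+-cancelʳ-≤ X _ _ (begin
    n ! * (K * G) + X                              ≡⟨ split (n !) K G d ⟩
    K * (n ! * (suc d * G))                        ≤⟨ *-monoʳ-≤ K (*-monoʳ-≤ (n !) avg) ⟩
    K * (n ! * degreeSum V E)                      ≤⟨ *-monoʳ-≤ K (n!*degreeSum≤ d) ⟩
    K * (S + n ! * (d * G))                        ≡⟨ *-distribˡ-+ K S _ ⟩
    K * S + X                                      ≤⟨ +-monoˡ-≤ X (sumBy-allOrderings-sumCube-monotoneWalks (suc d)) ⟩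
    n ! * sumCube (geodesics (suc d) allDirs) + X  ∎))
    where
    K G S X : ℕ
    K = suc d !
    G = vertexCount V
    S = sumBy (allOrderings n) (λ L → sumCube (monotoneWalks (suc d) L))
    X = K * (n ! * (d * G))
    split : ∀ p k g d → p * (k * g) + k * (p * (d * g)) ≡ k * (p * (suc d * g))
    split = solve-∀

theorem5 : (n d : ℕ) (V : Vertex n → Bool) (E : Vertex n → Fin n → Bool)
    → (∀ x i → E x i ≡ E (flipAt i x) i)
    → (∀ x i → E x i ≡ true → V x ≡ true)
    → d * vertexCount V ≤ degreeSum V E
    → (d !) * vertexCount V ≤ 2 * geodesicCount V E d
theorem5 n d V E E-sym E⇒V avg =
  ≤-trans (geodesics-lower-bound d avg) (geodesics≤2*geodesicCount d)
  where open Subgraph V E E-sym E⇒V
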